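{- Let $G$ be a convex bipartite graph satisfying Property A. Then $|X|=|Y|$ and $d_G(y)\ge 2$ for every $y\in Y$.
   Context: All graphs are finite, simple, connected and unweighted. A convex bipartite graph is a bipartite graph $G$ with bipartition $(X,Y)$ together with an ordering $X=(x_1,\ldots,x_n)$ such that for every $y\in Y$ the neighborhood $N_G(y)$ consists of consecutive vertices of this ordering; $n=|X|$. For $1\le p<q\le n$ let $X_{p..q}=\{x_p,\ldots,x_q\}$, $N_G[X_{p..q}]=\{y\in Y : N_G(y)\subseteq X_{p..q}\}$ and $N'_G[X_{p..q}]=\{y\in Y : |N_G(y)\cap X_{p..q}|\ge 2\}$. $G$ satisfies Property A if: (1) for all $1\le p<q\le n$ with $(p,q)\neq(1,n)$, $|N_G[X_{p..q}]|\le q-p$; (2) for every integer $j\in\{1,\ldots,n-1\}$ and all indices with $1\le p_1<q_1\le p_2<q_2\le\cdots\le p_j<q_j\le n$, $\left|\bigcup_{i=1}^j N'_G[X_{p_i..q_i}]\right|\ge\sum_{i=1}^j (q_i-p_i)$; (3) $|N_G[X_{1..n}]|=|N'_G[X_{1..n}]|=n$. -}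

module Defs where

open import Data.Nat using (ℕ; zero; suc; _+_; _∸_; _≤_; _<_; _≤ᵇ_)
open import Data.Bool using (Bool; true; false; _∧_; _∨_; not; if_then_else_)
open import Data.Fin using (Fin; toℕ)
import Data.Fin as F
open import Data.Sum using (_⊎_; inj₁; inj₂)
open import Data.Product using (_×_; _,_; proj₁; proj₂)
open import Data.List using (List; []; _∷_)
open import Data.Unit using (⊤)
open import Data.Empty using (⊥)
open import Relation.Binary.PropositionalEquality using (_≡_)
open import Relation.Binary.Construct.Closure.ReflexiveTransitive using (Star)

-- A bipartite graph with sides X = Fin n (in the order x_0,...,x_{n-1};
-- indices are 0-based) and Y = Fin m.  adj y x = true iff xy is an edge.
-- Simple and bipartite by construction (no loops, no multi-edges,
-- no edges inside X or inside Y).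
BipGraph : ℕ → ℕ → Set
BipGraph n m = Fin m → Fin n → Bool

count : {k : ℕ} → (Fin k → Bool) → ℕ
count {zero}  f = 0
count {suc k} f = (if f F.zero then 1 else 0) + count (λ i → f (F.suc i))

allB : {k : ℕ} → (Fin k → Bool) → Bool
allB {zero}  f = true
allB {suc k} f = f F.zero ∧ allB (λ i → f (F.suc i))

anyL : {A : Set} → (A → Bool) → List A → Bool
anyL f []       = false
anyL f (a ∷ as) = f a ∨ anyL f as

Vertex : ℕ → ℕ → Set
Vertex n m = Fin n ⊎ Fin m

Edge : {n m : ℕ} → BipGraph n m → Vertex n m → Vertex n m → Set
Edge G (inj₁ x) (inj₂ y) = G y x ≡ true
Edge G (inj₂ y) (inj₁ x) = G y x ≡ true
Edge G (inj₁ _) (inj₁ _) = ⊥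
Edge G (inj₂ _) (inj₂ _) = ⊥

Connected : {n m : ℕ} → BipGraph n m → Set
Connected {n} {m} G = (u v : Vertex n m) → Star (Edge G) u v

deg : {n m : ℕ} → BipGraph n m → Fin m → ℕ
deg G y = count (G y)

Convex : {n m : ℕ} → BipGraph n m → Set
Convex {n} {m} G = (y : Fin m) (i j k : Fin n) → toℕ i ≤ toℕ j → toℕ j ≤ toℕ k →
  G y i ≡ true → G y k ≡ true → G y j ≡ true

inX : {n : ℕ} → ℕ → ℕ → Fin n → Bool
inX p q x = (p ≤ᵇ toℕ x) ∧ (toℕ x ≤ᵇ q)

-- y ∈ N_G[X_{p..q}]  iff  N_G(y) ⊆ X_{p..q}
inNC : {n m : ℕ} → BipGraph n m → ℕ → ℕ → Fin m → Bool
inNC G p q y = allB (λ x → not (G y x) ∨ inX p q x)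

-- y ∈ N'_G[X_{p..q}]  iff  |N_G(y) ∩ X_{p..q}| ≥ 2
inN' : {n m : ℕ} → BipGraph n m → ℕ → ℕ → Fin m → Bool
inN' G p q y = 2 ≤ᵇ count (λ x → G y x ∧ inX p q x)

NC : {n m : ℕ} → BipGraph n m → ℕ → ℕ → ℕ
NC G p q = count (inNC G p q)

N' : {n m : ℕ} → BipGraph n m → ℕ → ℕ → ℕ
N' G p q = count (inN' G p q)

UnionN' : {n m : ℕ} → BipGraph n m → List (ℕ × ℕ) → ℕ
UnionN' G ivs = count (λ y → anyL (λ pq → inN' G (proj₁ pq) (proj₂ pq) y) ivs)

lenSum : List (ℕ × ℕ) → ℕ
lenSum []             = 0
lenSum ((p , q) ∷ r)  = (q ∸ p) + lenSum r

ChainFrom : ℕ → ℕ → List (ℕ × ℕ) → Set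
ChainFrom n b []            = ⊤
ChainFrom n b ((p , q) ∷ r) = (b ≤ p) × (p < q) × (q < n) × ChainFrom n q r

-- Property A (with 0-based indices: (1,n) becomes (0,n-1))
PropertyA : {n m : ℕ} → BipGraph n m → Set
PropertyA {n} {m} G =
  ((p q : ℕ) → p < q → q < n → ((p ≡ 0 × q ≡ n ∸ 1) → ⊥) → NC G p q ≤ q ∸ p)
  -- (2)  (1 ≤ j is nonemptiness; j ≤ n-1 is implied by the chain condition)
  × ((ivs : List (ℕ × ℕ)) → (ivs ≡ [] → ⊥) → ChainFrom n 0 ivs → lenSum ivs ≤ UnionN' G ivs)
  × (NC G 0 (n ∸ 1) ≡ n) × (N' G 0 (n ∸ 1) ≡ n)

module Submission where

-- Only clause (3) of Property A is needed; the interval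
-- X_{1..n} (0-based: X_{0..n-1}) is all of X.
--   * Since every x lies in X_{0..n-1}, every y satisfies N(y) ⊆ X_{0..n-1},
--     so N[X_{0..n-1}] = Y and clause (3) gives n = |N[X_{0..n-1}]| = |Y| = m.
--   * Likewise |N(y) ∩ X_{0..n-1}| = deg y, so N'[X_{0..n-1}] is the set of
--     y with deg y ≥ 2.  Clause (3) says this set has n = m = |Y| elements,
--     and a subset of Y with |Y| elements is all of Y, so every deg y ≥ 2.
-- The file first develops counting facts for boolean predicates on Fin k
-- (extensionality, counting a total predicate, and "a predicate counted k
-- times holds everywhere"), then the graph facts about the full interval,
-- and finally derives lemma5 from clause (3).

open import Defs
open import Data.Nat using (ℕ; zero; suc; _+_; _≤_; _∸_; z≤n; s≤s)
open import Data.Nat.Properties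
  using (≤ᵇ⇒≤; ≤⇒≤ᵇ; ≤-trans; n≤1+n; 1+n≰n; suc-injective)
open import Data.Fin using (Fin; toℕ)
import Data.Fin as F
open import Data.Fin.Properties using (toℕ≤pred[n])
open import Data.Bool using (Bool; true; false; not; _∧_; _∨_)
open import Data.Bool.Properties using (T-≡; ∨-zeroʳ; ∧-identityʳ)
open import Data.Empty using (⊥-elim)
open import Data.Product using (_×_; _,_)
open import Function.Bundles using (Equivalence)
open import Relation.Binary.PropositionalEquality
  using (_≡_; refl; sym; trans; cong; subst)

count-cong : ∀ {k} (f g : Fin k → Bool) → (∀ i → f i ≡ g i) → count f ≡ count g
count-cong {zero}  f g f≗g = refl
count-cong {suc k} f g f≗g rewrite f≗g F.zero =
  cong (_ +_) (count-cong (λ i → f (F.suc i)) (λ i → g (F.suc i)) (λ i → f≗g (F.suc i)))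

count-total : ∀ {k} (f : Fin k → Bool) → (∀ i → f i ≡ true) → count f ≡ k
count-total {zero}  f all = refl
count-total {suc k} f all rewrite all F.zero =
  cong suc (count-total (λ i → f (F.suc i)) (λ i → all (F.suc i)))

count≤size : ∀ {k} (f : Fin k → Bool) → count f ≤ k
count≤size {zero}  f = z≤n
count≤size {suc k} f with f F.zero
... | true  = s≤s (count≤size (λ i → f (F.suc i)))
... | false = ≤-trans (count≤size (λ i → f (F.suc i))) (n≤1+n k)

-- Conversely, a predicate counted k times on Fin k holds everywhere:
-- a single false value would leave at most k - 1 true ones.
count-maximal : ∀ {k} (f : Fin k → Bool) → count f ≡ k → ∀ i → f i ≡ true
count-maximal {suc k} f full i with f F.zero in f0
count-maximal {suc k} f full F.zero    | true = f0
count-maximal {suc k} f full (F.suc i) | true =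
  count-maximal (λ j → f (F.suc j)) (suc-injective full) i
... | false = ⊥-elim (1+n≰n (subst (_≤ k) full (count≤size (λ j → f (F.suc j)))))

allB-intro : ∀ {k} (f : Fin k → Bool) → (∀ i → f i ≡ true) → allB f ≡ true
allB-intro {zero}  f all = refl
allB-intro {suc k} f all rewrite all F.zero =
  allB-intro (λ i → f (F.suc i)) (λ i → all (F.suc i))

inX-full : ∀ {n} (x : Fin n) → inX 0 (n ∸ 1) x ≡ true
inX-full {suc k} x = Equivalence.to T-≡ (≤⇒≤ᵇ (toℕ≤pred[n] x))

inNC-full : ∀ {n m} (G : BipGraph n m) (y : Fin m) → inNC G 0 (n ∸ 1) y ≡ true
inNC-full {n} G y = allB-intro _ neighbour-in-X
  where
  neighbour-in-X : ∀ x → not (G y x) ∨ inX 0 (n ∸ 1) x ≡ true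
  neighbour-in-X x rewrite inX-full x = ∨-zeroʳ (not (G y x))

inN'-full : ∀ {n m} (G : BipGraph n m) (y : Fin m) →
  inN' G 0 (n ∸ 1) y ≡ true → 2 ≤ deg G y
inN'-full {n} G y y∈N' = subst (2 ≤_) neighbours-in-X≡deg
  (≤ᵇ⇒≤ 2 _ (Equivalence.from T-≡ y∈N'))
  where
  neighbours-in-X≡deg : count (λ x → G y x ∧ inX 0 (n ∸ 1) x) ≡ deg G y
  neighbours-in-X≡deg = count-cong _ _ λ x →
    trans (cong (G y x ∧_) (inX-full x)) (∧-identityʳ (G y x))

lemma5 : (n m : ℕ) (G : BipGraph n m) → Connected G → Convex G → PropertyA G →
    (n ≡ m) × ((y : Fin m) → 2 ≤ deg G y)
lemma5 n m G _ _ (_ , _ , |N[X]|≡n , |N'[X]|≡n) = n≡m , deg≥2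
  where
  n≡m : n ≡ m
  n≡m = trans (sym |N[X]|≡n) (count-total _ (inNC-full G))

  deg≥2 : (y : Fin m) → 2 ≤ deg G y
  deg≥2 y = inN'-full G y (count-maximal _ (trans |N'[X]|≡n n≡m) y)
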